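{- Let $n\ge1$, $0\le k\le n$ and let $w,w'\in\mathcal{W}^{(k)}_n$ be such that $w$ covers $w'$. Then (1) $w,w'$ is a pair of type B1 iff $(w')^{\vee},w^{\vee}$ is a pair of type B1; (2) $w,w'$ is a pair of type B2 iff $(w')^{\vee},w^{\vee}$ is a pair of type B2; (3) $w,w'$ is a pair of type B3 iff $(w')^{\vee},w^{\vee}$ is a pair of type B4.
   Context: $\mathcal{W}_n$ is the group of signed permutations of $\{ -n,\dots,n\}$ ($w(-i)=-w(i)$), written in one-line notation $w(1)\cdots w(n)$ with $\overline{a}=-a$; it is a Coxeter group generated by $s_0$ (sign change of the entry in position 1) and $s_i$, $1\le i\le n-1$ (swap of entries in positions $i,i+1$), with Coxeter length $\ell$ and Bruhat order $\le$; $w$ covers $w'$ means $w'\le w$ and $\ell(w)=\ell(w')+1$. $\mathcal{W}^{(k)}_n$ is the set of $w\in\mathcal{W}_n$ whose one-line notation has the form $u_1\cdots u_k\,|\,\overline{\lambda_r}\cdots\overline{\lambda_1}\,v_1\cdots v_{n-k-r}$ for some $r\ge0$, with $0<u_1<\dots<u_k$, $0<\lambda_1<\dots<\lambda_r$, $0<v_1<\dots<v_{n-k-r}$ (the $u$'s, $\lambda$'s, $v$'s of $w$). The dual is $w^{\vee}=u_1\cdots u_k\,|\,\overline{v_{n-k-r}}\cdots\overline{v_1}\,\lambda_1\cdots\lambda_r$. For $w,w'\in\mathcal{W}^{(k)}_n$ (positions of entries are kept in all replacements): - type B1: $1$ is one of the $\lambda$'s of $w$ and $w'$ is $w$ with $\overline1$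 replaced by $1$; - type B2: for some $a>0$, $a$ is one of the $\lambda$'s and $a-1$ one of the $v$'s of $w$, and $w'$ is $w$ with $\overline a$ replaced by $\overline{a-1}$ and $a-1$ replaced by $a$; - type B3: for some $a>x>0$, $a$ is one of the $u$'s and $a-x$ one of the $v$'s of $w$, and $w'$ is $w$ with entries $a$ and $a-x$ swapped; - type B4: for some $a>x>0$, $a-x$ is one of the $u$'s and $a$ one of the $\lambda$'s of $w$, and $w'$ is $w$ with $a-x$ replaced by $a$ and $\overline{a}$ replaced by $\overline{a-x}$. -}

module Defs where

open import Data.Nat using (ℕ; zero; suc; _≤_; _<_; _∸_)
open import Data.Integer using (ℤ; +_; -_; ∣_∣; _≟_)
open import Data.Fin using (Fin; zero; suc; toℕ)
open import Data.List using (List; []; _∷_; _++_; map; reverse; length; upTo)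
open import Data.List.Membership.Propositional using (_∈_)
open import Data.List.Relation.Unary.All using (All)
open import Data.List.Relation.Unary.Linked using (Linked)
open import Data.List.Relation.Binary.Permutation.Propositional using (_↭_)
open import Data.Product using (Σ; Σ-syntax; ∃; ∃-syntax; _×_; _,_)
open import Data.Bool using (if_then_else_)
open import Relation.Nullary using (does)
open import Relation.Binary.PropositionalEquality using (_≡_)
open import Relation.Binary.Construct.Closure.ReflexiveTransitive using (Star)

-- Signed permutations of size n, in one-line notation w(1) ⋯ w(n)
-- (a list of integers; w(-i) = -w(i) is implicit).

idW : ℕ → List ℤ
idW n = map (λ i → + suc i) (upTo n)

SignedPerm : ℕ → List ℤ → Set
SignedPerm n w = length w ≡ n × map ∣_∣ w ↭ map suc (upTo n)

-- Coxeter generators of 𝒲_n, indexed by Fin n: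
--   zero  ↦ s₀ (sign change of the entry in position 1)
--   suc j ↦ s_i with i = toℕ j + 1 (swap of entries in positions i, i+1)
-- acting on the right (w ↦ w s), i.e. on positions.

negHead : List ℤ → List ℤ
negHead []       = []
negHead (x ∷ xs) = (- x) ∷ xs

swapAt : ℕ → List ℤ → List ℤ
swapAt zero    (x ∷ y ∷ xs) = y ∷ x ∷ xs
swapAt zero    xs           = xs
swapAt (suc j) []           = []
swapAt (suc j) (x ∷ xs)     = x ∷ swapAt j xs

gen : ∀ {n} → Fin n → List ℤ → List ℤ
gen zero    w = negHead w
gen (suc j) w = swapAt (toℕ j) w

actW : ∀ {n} → List (Fin n) → List ℤ → List ℤ
actW []       w = w
actW (g ∷ gs) w = actW gs (gen g w)

HasLength : ℕ → List ℤ → ℕ → Set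
HasLength n w m =
  (Σ[ word ∈ List (Fin n) ] (length word ≡ m × actW word (idW n) ≡ w))
  × (∀ (word : List (Fin n)) → actW word (idW n) ≡ w → m ≤ length word)

-- y = x t for a reflection t = u s u⁻¹ (u a word, s a generator;
-- generators are involutions so u⁻¹ is the reversed word)
RightReflection : ℕ → List ℤ → List ℤ → Set
RightReflection n x y =
  Σ[ u ∈ List (Fin n) ] Σ[ s ∈ Fin n ] (y ≡ actW (u ++ (s ∷ reverse u)) x)

BruhatStep : ℕ → List ℤ → List ℤ → Set
BruhatStep n x y =
  RightReflection n x y ×
  (Σ[ p ∈ ℕ ] Σ[ q ∈ ℕ ] (HasLength n x p × HasLength n y q × p < q))

Bruhat : ℕ → List ℤ → List ℤ → Set
Bruhat n = Star (BruhatStep n)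

Covers : ℕ → List ℤ → List ℤ → Set
Covers n w w' =
  Bruhat n w' w × (Σ[ m ∈ ℕ ] (HasLength n w' m × HasLength n w (suc m)))

PosIncr : List ℕ → Set
PosIncr xs = All (λ x → 0 < x) xs × Linked _<_ xs

negs : List ℕ → List ℤ
negs xs = map (λ x → - (+ x)) xs

poss : List ℕ → List ℤ
poss xs = map +_ xs

-- w = u₁ ⋯ u_k | λ̄_r ⋯ λ̄₁ v₁ ⋯ v_{n-k-r}
record Shape (k : ℕ) (w : List ℤ) : Set where
  field
    us   : List ℕ
    lams : List ℕ
    vs   : List ℕ
    us-length : length us ≡ k
    us-inc    : PosIncr us
    lams-inc  : PosIncr lams
    vs-inc    : PosIncr vs
    decomp    : w ≡ poss us ++ (negs (reverse lams) ++ poss vs)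
open Shape public

record InWk (n k : ℕ) (w : List ℤ) : Set where
  field
    signed : SignedPerm n w
    shape  : Shape k w
open InWk public

dual : ∀ {n k w} → InWk n k w → List ℤ
dual hw = poss (us s) ++ (negs (reverse (vs s)) ++ poss (lams s))
  where s = shape hw

replace : ℤ → ℤ → List ℤ → List ℤ
replace a b = map (λ x → if does (x ≟ a) then b else x)

replace2 : ℤ → ℤ → ℤ → ℤ → List ℤ → List ℤ
replace2 a b c d =
  map (λ x → if does (x ≟ a) then b else (if does (x ≟ c) then d else x))

TypeB1 : ℕ → List ℤ → List ℤ → Set
TypeB1 k w w' =
  (Σ[ s ∈ Shape k w ] (1 ∈ lams s)) × (w' ≡ replace (- (+ 1)) (+ 1) w)

TypeB2 : ℕ → List ℤ → List ℤ → Set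
TypeB2 k w w' =
  Σ[ a ∈ ℕ ] (0 < a ×
    (Σ[ s ∈ Shape k w ] (a ∈ lams s × (a ∸ 1) ∈ vs s)) ×
    (w' ≡ replace2 (- (+ a)) (- (+ (a ∸ 1))) (+ (a ∸ 1)) (+ a) w))

TypeB3 : ℕ → List ℤ → List ℤ → Set
TypeB3 k w w' =
  Σ[ a ∈ ℕ ] Σ[ x ∈ ℕ ] (0 < x × x < a ×
    (Σ[ s ∈ Shape k w ] (a ∈ us s × (a ∸ x) ∈ vs s)) ×
    (w' ≡ replace2 (+ a) (+ (a ∸ x)) (+ (a ∸ x)) (+ a) w))

TypeB4 : ℕ → List ℤ → List ℤ → Set
TypeB4 k w w' =
  Σ[ a ∈ ℕ ] Σ[ x ∈ ℕ ] (0 < x × x < a ×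
    (Σ[ s ∈ Shape k w ] ((a ∸ x) ∈ us s × a ∈ lams s)) ×
    (w' ≡ replace2 (+ (a ∸ x)) (+ a) (- (+ a)) (- (+ (a ∸ x))) w))

module Submission where

-- An element w ∈ 𝒲^(k)_n is determined by the triple (u, λ, v) of its
-- decomposition  w = u | λ̄_r ⋯ λ̄₁ v  (the decomposition is unique, and the
-- three lists are pairwise disjoint because w is a signed permutation), and the
-- dual  w^∨  is the triple (u, v, λ).  Each replacement in the definition of the
-- types acts on triples by renaming one value inside the lists:
--   B1 moves 1 from λ to v;  B2 and B4 exchange a with b (positive b becomes a,
--   negative a becomes negative b);  B3 renames a ↦ b in u and b ↦ a in v.
-- So every type is a relation between triples (Rel1 … Rel4), and the theorem
-- reduces to pure list algebra: for a pair (t, t') of type B1/B2/B3/B4 the pair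
-- (t'^∨, t^∨) is of type B1/B2/B4/B3, since applying the same renaming again
-- undoes the first one (this is where disjointness of u, λ, v is used).

open import Defs
open import Data.Nat as ℕ using (ℕ; zero; suc; _≤_; _<_; _∸_)
open import Data.Nat.Properties using (suc-injective; <-trans; <-irrefl; <⇒≱; m<n⇒0<n∸m)
open import Data.Integer using (ℤ; +_; -_; ∣_∣; _≟_)
open import Data.Integer.Properties using (+-injective; neg-injective; ∣-i∣≡∣i∣)
open import Data.List using (List; []; _∷_; _++_; [_]; map; reverse; length)
open import Data.List.Properties
  using (∷-injective; map-++; map-∘; map-id; map-id-local; map-cong-local; map-injective;
         length-map; reverse-map; reverse-injective; unfold-reverse; ++-assoc)
open import Data.List.Membership.Propositional using (_∈_; _∉_)
open import Data.List.Membership.Propositional.Properties using (∈-map⁺)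
open import Data.List.Relation.Unary.Any using (here; there)
open import Data.List.Relation.Unary.Any.Properties using (++⁺ˡ; ++⁺ʳ; reverse⁺; reverse⁻)
open import Data.List.Relation.Unary.All as All using (All; _∷_)
open import Data.List.Relation.Unary.All.Properties as AllP using ()
open import Data.List.Relation.Unary.AllPairs using (_∷_) renaming (head to allPairs-head)
open import Data.List.Relation.Unary.Linked using (Linked)
open import Data.List.Relation.Unary.Linked.Properties using (Linked⇒AllPairs)
open import Data.List.Relation.Unary.Unique.Propositional using (Unique)
open import Data.List.Relation.Unary.Unique.Propositional.Properties as UniqueP using ()
open import Data.List.Relation.Binary.Disjoint.Propositional using (Disjoint)
import Data.List.Relation.Binary.Disjoint.Propositional.Properties as Disjoint
open import Data.List.Relation.Binary.Permutation.Propositional using (↭-sym; ↭⇒↭ₛ)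
open import Data.List.Relation.Binary.Permutation.Setoid.Properties
  using (Unique-resp-↭)
open import Data.Product using (Σ-syntax; _×_; _,_; proj₁; proj₂)
open import Data.Bool using (true; false; if_then_else_)
open import Data.Empty using (⊥-elim)
open import Function using (_∘_)
open import Function.Bundles using (_⇔_; mk⇔; Equivalence)
open import Function.Properties.Equivalence using () renaming (trans to ⇔-trans; sym to ⇔-sym)
open import Relation.Nullary using (does; yes; no)
open import Relation.Nullary.Decidable using (dec-true; dec-false)
open import Relation.Binary.PropositionalEquality
  using (_≡_; _≢_; refl; sym; trans; cong; cong₂; subst; setoid; module ≡-Reasoning)
open ≡-Reasoning

record Triple : Set where
  constructor triple
  field
    U L V : List ℕ
open Triple

embed : Triple → List ℤ
embed t = poss (U t) ++ (negs (reverse (L t)) ++ poss (V t))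

swapLV : Triple → Triple
swapLV t = triple (U t) (V t) (L t)

tripleOf : ∀ {k w} → Shape k w → Triple
tripleOf s = triple (us s) (lams s) (vs s)

triple-≡ : ∀ {s t} → U s ≡ U t → L s ≡ L t → V s ≡ V t → s ≡ t
triple-≡ {triple _ _ _} {triple _ _ _} refl refl refl = refl

dualShape : ∀ {n k w} (hw : InWk n k w) → Shape k (dual hw)
dualShape hw = record
  { us = us S ; lams = vs S ; vs = lams S ; us-length = us-length S
  ; us-inc = us-inc S ; lams-inc = vs-inc S ; vs-inc = lams-inc S ; decomp = refl }
  where S = shape hw

poss-prefix-injective : ∀ {xs ys : List ℕ} {r r' : List ℤ} → length xs ≡ length ys →
  poss xs ++ r ≡ poss ys ++ r' → xs ≡ ys × r ≡ r'
poss-prefix-injective {[]}     {[]}     _   e = refl , e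
poss-prefix-injective {x ∷ xs} {y ∷ ys} len e =
  let x≡y , rest = ∷-injective e
      xs≡ys , r≡r' = poss-prefix-injective (suc-injective len) rest
  in cong₂ _∷_ (+-injective x≡y) xs≡ys , r≡r'

-- negative entries followed by positive ones: the sign change locates the
-- boundary, provided no entry of the first list is 0
negs-poss-injective : ∀ {A A' B B' : List ℕ} → All (0 <_) A → All (0 <_) B →
  negs A ++ poss B ≡ negs A' ++ poss B' → A ≡ A' × B ≡ B'
negs-poss-injective {[]}    {[]}         _ _ e = refl , map-injective +-injective e
negs-poss-injective {[]}    {_ ∷ _}      {[]} _ _ ()
negs-poss-injective {[]}    {zero ∷ _}   {_ ∷ _} _ (ℕ.s≤s ℕ.z≤n ∷ _) ()
negs-poss-injective {[]}    {suc _ ∷ _}  {_ ∷ _} _ _ ()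
negs-poss-injective {_ ∷ _} {[]} {B' = []} _ _ ()
negs-poss-injective {_ ∷ _} {[]} {B' = _ ∷ _} (ℕ.s≤s ℕ.z≤n ∷ _) _ ()
negs-poss-injective {_ ∷ _} {_ ∷ _} (_ ∷ posA) posB e =
  let hd , rest = ∷-injective e
      A≡A' , B≡B' = negs-poss-injective posA posB rest
  in cong₂ _∷_ (+-injective (neg-injective hd)) A≡A' , B≡B'

reverse-all : ∀ {P : ℕ → Set} {xs} → All P xs → All P (reverse xs)
reverse-all p = All.tabulate (All.lookup p ∘ reverse⁻)

-- embed is injective on triples with equally long u's whose λ and v entries
-- are nonzero (so that 0 = 0̄ causes no ambiguity)
embed-injective : ∀ s t → length (U s) ≡ length (U t) →
  All (0 <_) (L s) → All (0 <_) (V s) → embed s ≡ embed t → s ≡ t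
embed-injective s t len posL posV e =
  let U≡ , rest = poss-prefix-injective len e
      revL≡ , V≡ = negs-poss-injective (reverse-all posL) posV rest
  in triple-≡ U≡ (reverse-injective revL≡) V≡

shape-unique : ∀ {k w} (s s₀ : Shape k w) → tripleOf s ≡ tripleOf s₀
shape-unique s s₀ =
  embed-injective (tripleOf s) (tripleOf s₀) (trans (us-length s) (sym (us-length s₀)))
    (proj₁ (lams-inc s)) (proj₁ (vs-inc s)) (trans (sym (decomp s)) (decomp s₀))

replacement⇔triple : ∀ {k w w'} (S : Shape k w) (S' : Shape k w') {f : ℤ → ℤ} {t' : Triple} →
  length (U t') ≡ k → map f (embed (tripleOf S)) ≡ embed t' →
  (w' ≡ map f w) ⇔ (tripleOf S' ≡ t')
replacement⇔triple {w = w} {w'} S S' {f} {t'} len acts = mk⇔ to from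
  where
  to : w' ≡ map f w → tripleOf S' ≡ t'
  to e = embed-injective (tripleOf S') t' (trans (us-length S') (sym len))
    (proj₁ (lams-inc S')) (proj₁ (vs-inc S')) (begin
      embed (tripleOf S')          ≡⟨ sym (decomp S') ⟩
      w'                           ≡⟨ e ⟩
      map f w                      ≡⟨ cong (map f) (decomp S) ⟩
      map f (embed (tripleOf S))   ≡⟨ acts ⟩
      embed t'                     ∎)
  from : tripleOf S' ≡ t' → w' ≡ map f w
  from eq = begin
    w'                           ≡⟨ decomp S' ⟩
    embed (tripleOf S')          ≡⟨ cong embed eq ⟩
    embed t'                     ≡⟨ sym acts ⟩
    map f (embed (tripleOf S))   ≡⟨ cong (map f) (sym (decomp S)) ⟩
    map f w                      ∎

record Separated (t : Triple) : Set where
  field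
    UL : Disjoint (U t) (L t)
    UV : Disjoint (U t) (V t)
    LV : Disjoint (L t) (V t)
open Separated

swapLV-separated : ∀ {t} → Separated t → Separated (swapLV t)
swapLV-separated sep = record { UL = UV sep ; UV = UL sep ; LV = Disjoint.sym (LV sep) }

unique-++-disjoint : ∀ (xs : List ℕ) {ys} → Unique (xs ++ ys) → Disjoint xs ys
unique-++-disjoint (x ∷ xs) (x∉ys ∷ _)  (here refl , x∈ys) = All.lookup (AllP.++⁻ʳ xs x∉ys) x∈ys refl
unique-++-disjoint (x ∷ xs) (_ ∷ unique) (there y∈xs , y∈ys) = unique-++-disjoint xs unique (y∈xs , y∈ys)

unique-++ʳ : ∀ (xs : List ℕ) {ys} → Unique (xs ++ ys) → Unique ys
unique-++ʳ []       unique       = unique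
unique-++ʳ (x ∷ xs) (_ ∷ unique) = unique-++ʳ xs unique

abs-embed : ∀ t → map ∣_∣ (embed t) ≡ U t ++ (reverse (L t) ++ V t)
abs-embed t = begin
  map ∣_∣ (embed t)
    ≡⟨ map-++ ∣_∣ (poss (U t)) _ ⟩
  map ∣_∣ (poss (U t)) ++ map ∣_∣ (negs (reverse (L t)) ++ poss (V t))
    ≡⟨ cong (map ∣_∣ (poss (U t)) ++_) (map-++ ∣_∣ (negs (reverse (L t))) _) ⟩
  map ∣_∣ (poss (U t)) ++ (map ∣_∣ (negs (reverse (L t))) ++ map ∣_∣ (poss (V t)))
    ≡⟨ cong₂ (λ x y → x ++ (y ++ map ∣_∣ (poss (V t)))) (abs-poss (U t)) (abs-negs (reverse (L t))) ⟩
  U t ++ (reverse (L t) ++ map ∣_∣ (poss (V t)))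
    ≡⟨ cong (λ z → U t ++ (reverse (L t) ++ z)) (abs-poss (V t)) ⟩
  U t ++ (reverse (L t) ++ V t) ∎
  where
  abs-poss : ∀ xs → map ∣_∣ (poss xs) ≡ xs
  abs-poss xs = trans (sym (map-∘ xs)) (map-id xs)
  abs-negs : ∀ xs → map ∣_∣ (negs xs) ≡ xs
  abs-negs xs = trans (sym (map-∘ xs)) (map-id-local (All.universal (∣-i∣≡∣i∣ ∘ +_) xs))

separated : ∀ {n k w} (hw : InWk n k w) → Separated (tripleOf (shape hw))
separated {n} {k} {w} hw = record
  { UL = λ (y∈U , y∈L) → u#λv (y∈U , ++⁺ˡ (reverse⁺ y∈L))
  ; UV = λ (y∈U , y∈V) → u#λv (y∈U , ++⁺ʳ (reverse (L t)) y∈V)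
  ; LV = λ (y∈L , y∈V) → λ#v (reverse⁺ y∈L , y∈V) }
  where
  S : Shape k w
  S = shape hw
  t : Triple
  t = tripleOf S
  -- the absolute values are a permutation of 1 … n, hence distinct
  entries-unique : Unique (U t ++ (reverse (L t) ++ V t))
  entries-unique = subst Unique (trans (cong (map ∣_∣) (decomp S)) (abs-embed t))
    (Unique-resp-↭ (setoid ℕ) (↭⇒↭ₛ (↭-sym (proj₂ (signed hw))))
      (UniqueP.map⁺ suc-injective (UniqueP.upTo⁺ n)))
  u#λv : Disjoint (U t) (reverse (L t) ++ V t)
  u#λv = unique-++-disjoint (U t) entries-unique
  λ#v : Disjoint (reverse (L t)) (V t)
  λ#v = unique-++-disjoint (reverse (L t)) (unique-++ʳ (U t) entries-unique)

relabel : ℕ → ℕ → ℕ → ℕ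
relabel c d y = if does (y ℕ.≟ c) then d else y

skip-if : ∀ {A : Set} {y c} (p q : A) → y ≢ c → (if does (y ℕ.≟ c) then p else q) ≡ q
skip-if {y = y} {c} p q y≢c = cong (λ b → if b then p else q) (dec-false (y ℕ.≟ c) y≢c)

relabel-hit : ∀ c d → relabel c d c ≡ d
relabel-hit c d = cong (λ b → if b then d else c) (dec-true (c ℕ.≟ c) refl)

relabel-fix : ∀ {c d y} → y ≢ c → relabel c d y ≡ y
relabel-fix {c} {d} {y} = skip-if d y

relabel-undo : ∀ {c d y} → y ≢ d → relabel d c (relabel c d y) ≡ y
relabel-undo {c} {d} {y} y≢d with y ℕ.≟ c
... | yes refl = trans (cong (relabel d y) (relabel-hit y d)) (relabel-hit d y)
... | no y≢c   = trans (cong (relabel d c) (relabel-fix y≢c)) (relabel-fix y≢d)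

relabel-∈ : ∀ {c d xs} → c ∈ xs → d ∈ map (relabel c d) xs
relabel-∈ {c} {d} {xs} c∈xs = subst (_∈ map (relabel c d) xs) (relabel-hit c d) (∈-map⁺ (relabel c d) c∈xs)

avoid : ∀ {xs ys : List ℕ} {z} → Disjoint xs ys → z ∈ ys → All (_≢ z) xs
avoid xs#ys z∈ys = All.tabulate λ y∈xs y≡z → xs#ys (y∈xs , subst (_∈ _) (sym y≡z) z∈ys)

relabel-fixes : ∀ {xs ys : List ℕ} {c d} → Disjoint xs ys → c ∈ ys →
  map (relabel c d) xs ≡ xs
relabel-fixes xs#ys c∈ys = map-id-local (All.map relabel-fix (avoid xs#ys c∈ys))

relabel-undoes : ∀ {xs ys : List ℕ} {c d} → Disjoint xs ys → d ∈ ys →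
  map (relabel d c) (map (relabel c d) xs) ≡ xs
relabel-undoes {xs} xs#ys d∈ys =
  trans (sym (map-∘ xs)) (map-id-local (All.map relabel-undo (avoid xs#ys d∈ys)))

replaceEntry : ℤ → ℤ → ℤ → ℤ
replaceEntry a b x = if does (x ≟ a) then b else x

replace2Entry : ℤ → ℤ → ℤ → ℤ → ℤ → ℤ
replace2Entry a b c d x = if does (x ≟ a) then b else (if does (x ≟ c) then d else x)

map-conjugate : ∀ {A B : Set} (f : B → B) (s : A → B) (p : A → A) {xs} →
  All (λ y → f (s y) ≡ s (p y)) xs → map f (map s xs) ≡ map s (map p xs)
map-conjugate f s p {xs} h = begin
  map f (map s xs)   ≡⟨ sym (map-∘ xs) ⟩
  map (f ∘ s) xs     ≡⟨ map-cong-local h ⟩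
  map (s ∘ p) xs     ≡⟨ map-∘ xs ⟩
  map s (map p xs)   ∎

embed-map : ∀ (f : ℤ → ℤ) (p q r : ℕ → ℕ) t →
  All (λ y → f (+ y) ≡ + p y) (U t) → All (λ y → f (- (+ y)) ≡ - (+ q y)) (L t) →
  All (λ y → f (+ y) ≡ + r y) (V t) →
  map f (embed t) ≡ embed (triple (map p (U t)) (map q (L t)) (map r (V t)))
embed-map f p q r t hu hl hv = begin
  map f (embed t)
    ≡⟨ map-++ f (poss (U t)) _ ⟩
  map f (poss (U t)) ++ map f (negs (reverse (L t)) ++ poss (V t))
    ≡⟨ cong (map f (poss (U t)) ++_) (map-++ f (negs (reverse (L t))) _) ⟩
  map f (poss (U t)) ++ (map f (negs (reverse (L t))) ++ map f (poss (V t)))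
    ≡⟨ cong₂ _++_ (map-conjugate f +_ p hu) (cong₂ _++_ negative-part (map-conjugate f +_ r hv)) ⟩
  embed (triple (map p (U t)) (map q (L t)) (map r (V t))) ∎
  where
  negative-part : map f (negs (reverse (L t))) ≡ negs (reverse (map q (L t)))
  negative-part = trans (map-conjugate f (-_ ∘ +_) q (reverse-all hl))
                        (cong negs (reverse-map q (L t)))

exchangeT : ℕ → ℕ → Triple → Triple
exchangeT a b t = triple (map (relabel b a) (U t)) (map (relabel a b) (L t)) (map (relabel b a) (V t))

exchange-action : ∀ {a b} (f : ℤ → ℤ) → (∀ y → f (+ y) ≡ + relabel b a y) →
  (∀ y → f (- (+ y)) ≡ - (+ relabel a b y)) → ∀ t → map f (embed t) ≡ embed (exchangeT a b t)
exchange-action f pos neg t =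
  embed-map f _ _ _ t (All.universal pos _) (All.universal neg _) (All.universal pos _)

-- The entrywise maps of B2 and B4 both realise exchange a b.  For positive a, b
-- the integer tests reduce to the test  y ≡ᵇ c  on naturals, on which we split.
b2-entry-pos : ∀ {a b} → 0 < a → 0 < b → ∀ y →
  replace2Entry (- (+ a)) (- (+ b)) (+ b) (+ a) (+ y) ≡ + relabel b a y
b2-entry-pos {suc a} {suc b} _ _ y with y ℕ.≡ᵇ suc b
... | true  = refl
... | false = refl

b2-entry-neg : ∀ {a b} → 0 < a → 0 < b → ∀ y →
  replace2Entry (- (+ a)) (- (+ b)) (+ b) (+ a) (- (+ y)) ≡ - (+ relabel a b y)
b2-entry-neg {suc a} {suc b} _ _ zero = refl
b2-entry-neg {suc a} {suc b} _ _ (suc y) with y ℕ.≡ᵇ a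
... | true  = refl
... | false = refl

b4-entry-pos : ∀ {a b} → 0 < a → 0 < b → ∀ y →
  replace2Entry (+ b) (+ a) (- (+ a)) (- (+ b)) (+ y) ≡ + relabel b a y
b4-entry-pos {suc a} {suc b} _ _ y with y ℕ.≡ᵇ suc b
... | true  = refl
... | false = refl

b4-entry-neg : ∀ {a b} → 0 < a → 0 < b → ∀ y →
  replace2Entry (+ b) (+ a) (- (+ a)) (- (+ b)) (- (+ y)) ≡ - (+ relabel a b y)
b4-entry-neg {suc a} {suc b} _ _ zero = refl
b4-entry-neg {suc a} {suc b} _ _ (suc y) with y ℕ.≡ᵇ a
... | true  = refl
... | false = refl

transposeT : ℕ → ℕ → Triple → Triple
transposeT a b t = triple (map (relabel a b) (U t)) (L t) (map (relabel b a) (V t))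

-- The entrywise map of B3 swaps a and b; on u (where b is absent) it renames
-- a to b, on v (where a is absent) b to a, and it fixes negative entries.
b3-entry-U : ∀ {a b} y → y ≢ b → replace2Entry (+ a) (+ b) (+ b) (+ a) (+ y) ≡ + relabel a b y
b3-entry-U {a} {b} y y≢b with y ℕ.≡ᵇ a
... | true  = refl
... | false = skip-if (+ a) (+ y) y≢b

b3-entry-V : ∀ {a b} y → y ≢ a → replace2Entry (+ a) (+ b) (+ b) (+ a) (+ y) ≡ + relabel b a y
b3-entry-V {a} {b} y y≢a with y ℕ.≡ᵇ b
... | true  = skip-if (+ b) (+ a) y≢a
... | false = skip-if (+ b) (+ y) y≢a

b3-entry-neg : ∀ {a b} → 0 < a → 0 < b → ∀ y →
  replace2Entry (+ a) (+ b) (+ b) (+ a) (- (+ y)) ≡ - (+ y)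
b3-entry-neg {suc a} {suc b} _ _ zero    = refl
b3-entry-neg {suc a} {suc b} _ _ (suc y) = refl

transpose-action : ∀ {a b} → 0 < a → 0 < b → ∀ t → All (_≢ b) (U t) → All (_≢ a) (V t) →
  map (replace2Entry (+ a) (+ b) (+ b) (+ a)) (embed t) ≡ embed (transposeT a b t)
transpose-action 0<a 0<b t U≢b V≢a =
  trans (embed-map _ _ (λ y → y) _ t (All.map (b3-entry-U _) U≢b)
                   (All.universal (b3-entry-neg 0<a 0<b) _) (All.map (b3-entry-V _) V≢a))
        (cong (λ l → embed (triple (map (relabel _ _) (U t)) l (map (relabel _ _) (V t)))) (map-id (L t)))

move-one-action : ∀ t {l} → L t ≡ 1 ∷ l → 1 ∉ l →
  map (replaceEntry (- (+ 1)) (+ 1)) (embed t) ≡ embed (triple (U t) l (1 ∷ V t))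
move-one-action (triple u _ v) {l} refl 1∉l = begin
  map f (poss u ++ (negs (reverse (1 ∷ l)) ++ poss v))
    ≡⟨ cong (λ r → map f (poss u ++ (negs r ++ poss v))) (unfold-reverse 1 l) ⟩
  map f (poss u ++ (negs (reverse l ++ [ 1 ]) ++ poss v))
    ≡⟨ cong (λ r → map f (poss u ++ (r ++ poss v))) (map-++ _ (reverse l) [ 1 ]) ⟩
  map f (poss u ++ ((negs (reverse l) ++ [ - (+ 1) ]) ++ poss v))
    ≡⟨ cong (λ r → map f (poss u ++ r)) (++-assoc (negs (reverse l)) _ (poss v)) ⟩
  map f (poss u ++ (negs (reverse l) ++ (- (+ 1) ∷ poss v)))
    ≡⟨ map-++ f (poss u) _ ⟩
  map f (poss u) ++ map f (negs (reverse l) ++ (- (+ 1) ∷ poss v))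
    ≡⟨ cong (map f (poss u) ++_) (map-++ f (negs (reverse l)) _) ⟩
  map f (poss u) ++ (map f (negs (reverse l)) ++ (+ 1 ∷ map f (poss v)))
    ≡⟨ cong₂ (λ x y → x ++ (y ++ (+ 1 ∷ map f (poss v))))
             (fixes-positives u) (map-id-local (AllP.map⁺ (reverse-all (All.tabulate fixes-negative)))) ⟩
  poss u ++ (negs (reverse l) ++ (+ 1 ∷ map f (poss v)))
    ≡⟨ cong (λ r → poss u ++ (negs (reverse l) ++ (+ 1 ∷ r))) (fixes-positives v) ⟩
  poss u ++ (negs (reverse l) ++ (+ 1 ∷ poss v)) ∎
  where
  f : ℤ → ℤ
  f = replaceEntry (- (+ 1)) (+ 1)
  fixes-positives : ∀ xs → map f (poss xs) ≡ poss xs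
  fixes-positives xs = map-id-local (AllP.map⁺ (All.universal (λ _ → refl) xs))
  fixes-negative : ∀ {y} → y ∈ l → f (- (+ y)) ≡ - (+ y)
  fixes-negative {zero}  _   = refl
  fixes-negative {suc y} y∈l = skip-if (+ 1) (- (+ suc y)) λ y≡0 → 1∉l (subst (_∈ l) (cong suc y≡0) y∈l)

Rel1 : Triple → Triple → Set
Rel1 t t' = Σ[ l ∈ List ℕ ] (L t ≡ 1 ∷ l × 1 ∉ l × t' ≡ triple (U t) l (1 ∷ V t))

Rel2 : Triple → Triple → Set
Rel2 t t' = Σ[ a ∈ ℕ ] (0 < a × a ∈ L t × (a ∸ 1) ∈ V t × t' ≡ exchangeT a (a ∸ 1) t)

Rel3 : Triple → Triple → Set
Rel3 t t' = Σ[ a ∈ ℕ ] Σ[ x ∈ ℕ ]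
  (0 < x × x < a × a ∈ U t × (a ∸ x) ∈ V t × t' ≡ transposeT a (a ∸ x) t)

Rel4 : Triple → Triple → Set
Rel4 t t' = Σ[ a ∈ ℕ ] Σ[ x ∈ ℕ ]
  (0 < x × x < a × (a ∸ x) ∈ U t × a ∈ L t × t' ≡ exchangeT a (a ∸ x) t)

dual-B1 : ∀ {t t'} → Separated t → Rel1 t t' → Rel1 (swapLV t') (swapLV t)
dual-B1 {t} sep (l , L≡ , _ , refl) =
  V t , refl , (λ 1∈V → LV sep (subst (1 ∈_) (sym L≡) (here refl) , 1∈V)) , triple-≡ refl refl L≡

-- B2 is self-dual: exchanging a and a-1 again undoes the exchange
dual-B2 : ∀ {t t'} → Separated t → Rel2 t t' → Rel2 (swapLV t') (swapLV t)
dual-B2 {t} sep (a , 0<a , a∈L , b∈V , refl) =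
  a , 0<a , relabel-∈ b∈V , relabel-∈ a∈L ,
  triple-≡ (sym (trans (cong (map (relabel (a ∸ 1) a)) fixes) fixes))
           (sym (relabel-undoes (Disjoint.sym (LV sep)) a∈L))
           (sym (relabel-undoes (LV sep) b∈V))
  where
  fixes : map (relabel (a ∸ 1) a) (U t) ≡ U t
  fixes = relabel-fixes (UV sep) b∈V

dual-B3 : ∀ {t t'} → Separated t → Rel3 t t' → Rel4 (swapLV t') (swapLV t)
dual-B3 sep (a , x , 0<x , x<a , a∈U , b∈V , refl) =
  a , x , 0<x , x<a , relabel-∈ a∈U , relabel-∈ b∈V ,
  triple-≡ (sym (relabel-undoes (UV sep) b∈V))
           (sym (relabel-undoes (Disjoint.sym (UV sep)) a∈U))
           (sym (relabel-fixes (LV sep) b∈V))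

dual-B4 : ∀ {t t'} → Separated t → Rel4 t t' → Rel3 (swapLV t') (swapLV t)
dual-B4 sep (a , x , 0<x , x<a , b∈U , a∈L , refl) =
  a , x , 0<x , x<a , relabel-∈ b∈U , relabel-∈ a∈L ,
  triple-≡ (sym (relabel-undoes (UL sep) a∈L))
           (sym (relabel-fixes (Disjoint.sym (UV sep)) b∈U))
           (sym (relabel-undoes (Disjoint.sym (UL sep)) b∈U))

increasing-tail : ∀ {x xs} → Linked _<_ (x ∷ xs) → All (x <_) xs
increasing-tail = allPairs-head ∘ Linked⇒AllPairs <-trans

one-is-head : ∀ {xs} → PosIncr xs → 1 ∈ xs → Σ[ l ∈ List ℕ ] (xs ≡ 1 ∷ l × 1 ∉ l)
one-is-head {_ ∷ l} (_ , increasing) (here refl) =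
  l , refl , λ 1∈l → <-irrefl refl (All.lookup (increasing-tail increasing) 1∈l)
one-is-head (x>0 ∷ _ , increasing) (there 1∈l) =
  ⊥-elim (<⇒≱ (All.lookup (increasing-tail increasing) 1∈l) x>0)

-- The types B1–B4 between w and w' are the relations Rel1–Rel4 between their
-- triples; B3 needs disjointness to describe the swap as two renamings.

module _ {k : ℕ} {w w' : List ℤ} (S : Shape k w) (S' : Shape k w') where

  private
    t t' : Triple
    t  = tripleOf S
    t' = tripleOf S'

    transport : ∀ (s : Shape k w) (P : Triple → Set) → P (tripleOf s) → P t
    transport s P = subst P (shape-unique s S)

    renamed-length : ∀ (g : ℕ → ℕ) → length (map g (us S)) ≡ k
    renamed-length g = trans (length-map g (us S)) (us-length S)

  typeB1⇔ : TypeB1 k w w' ⇔ Rel1 t t'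
  typeB1⇔ = mk⇔ to from
    where
    replacement : ∀ {l} → L t ≡ 1 ∷ l → 1 ∉ l →
      (w' ≡ replace (- (+ 1)) (+ 1) w) ⇔ (t' ≡ triple (U t) l (1 ∷ V t))
    replacement L≡ 1∉l = replacement⇔triple S S' (us-length S) (move-one-action t L≡ 1∉l)
    to : TypeB1 k w w' → Rel1 t t'
    to ((s , 1∈) , e) =
      let l , L≡ , 1∉l = one-is-head (lams-inc S) (transport s (λ t → 1 ∈ L t) 1∈)
      in l , L≡ , 1∉l , Equivalence.to (replacement L≡ 1∉l) e
    from : Rel1 t t' → TypeB1 k w w'
    from (l , L≡ , 1∉l , eq) =
      (S , subst (1 ∈_) (sym L≡) (here refl)) , Equivalence.from (replacement L≡ 1∉l) eq

  typeB2⇔ : TypeB2 k w w' ⇔ Rel2 t t'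
  typeB2⇔ = mk⇔ to from
    where
    replacement : ∀ {a} → 0 < a → (a ∸ 1) ∈ V t →
      (w' ≡ replace2 (- (+ a)) (- (+ (a ∸ 1))) (+ (a ∸ 1)) (+ a) w) ⇔ (t' ≡ exchangeT a (a ∸ 1) t)
    replacement 0<a b∈V =
      let 0<b = All.lookup (proj₁ (vs-inc S)) b∈V
      in replacement⇔triple S S' (renamed-length _)
           (exchange-action _ (b2-entry-pos 0<a 0<b) (b2-entry-neg 0<a 0<b) t)
    to : TypeB2 k w w' → Rel2 t t'
    to (a , 0<a , (s , a∈ , b∈) , e) =
      let b∈V = transport s (λ t → (a ∸ 1) ∈ V t) b∈
      in a , 0<a , transport s (λ t → a ∈ L t) a∈ , b∈V , Equivalence.to (replacement 0<a b∈V) e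
    from : Rel2 t t' → TypeB2 k w w'
    from (a , 0<a , a∈L , b∈V , eq) =
      a , 0<a , (S , a∈L , b∈V) , Equivalence.from (replacement 0<a b∈V) eq

  typeB3⇔ : Separated t → TypeB3 k w w' ⇔ Rel3 t t'
  typeB3⇔ sep = mk⇔ to from
    where
    replacement : ∀ {a x} → 0 < x → x < a → a ∈ U t → (a ∸ x) ∈ V t →
      (w' ≡ replace2 (+ a) (+ (a ∸ x)) (+ (a ∸ x)) (+ a) w) ⇔ (t' ≡ transposeT a (a ∸ x) t)
    replacement 0<x x<a a∈U b∈V = replacement⇔triple S S' (renamed-length _)
      (transpose-action (<-trans 0<x x<a) (m<n⇒0<n∸m x<a) t
        (avoid (UV sep) b∈V) (avoid (Disjoint.sym (UV sep)) a∈U))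
    to : TypeB3 k w w' → Rel3 t t'
    to (a , x , 0<x , x<a , (s , a∈ , b∈) , e) =
      let a∈U = transport s (λ t → a ∈ U t) a∈
          b∈V = transport s (λ t → (a ∸ x) ∈ V t) b∈
      in a , x , 0<x , x<a , a∈U , b∈V , Equivalence.to (replacement 0<x x<a a∈U b∈V) e
    from : Rel3 t t' → TypeB3 k w w'
    from (a , x , 0<x , x<a , a∈U , b∈V , eq) =
      a , x , 0<x , x<a , (S , a∈U , b∈V) , Equivalence.from (replacement 0<x x<a a∈U b∈V) eq

  typeB4⇔ : TypeB4 k w w' ⇔ Rel4 t t'
  typeB4⇔ = mk⇔ to from
    where
    replacement : ∀ {a x} → 0 < x → x < a →
      (w' ≡ replace2 (+ (a ∸ x)) (+ a) (- (+ a)) (- (+ (a ∸ x))) w) ⇔ (t' ≡ exchangeT a (a ∸ x) t)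
    replacement 0<x x<a =
      let 0<a = <-trans 0<x x<a
          0<b = m<n⇒0<n∸m x<a
      in replacement⇔triple S S' (renamed-length _)
           (exchange-action _ (b4-entry-pos 0<a 0<b) (b4-entry-neg 0<a 0<b) t)
    to : TypeB4 k w w' → Rel4 t t'
    to (a , x , 0<x , x<a , (s , b∈ , a∈) , e) =
      a , x , 0<x , x<a , transport s (λ t → (a ∸ x) ∈ U t) b∈ , transport s (λ t → a ∈ L t) a∈ ,
      Equivalence.to (replacement 0<x x<a) e
    from : Rel4 t t' → TypeB4 k w w'
    from (a , x , 0<x , x<a , b∈U , a∈L , eq) =
      a , x , 0<x , x<a , (S , b∈U , a∈L) , Equivalence.from (replacement 0<x x<a) eq

mainTheorem7 : (n k : ℕ) → 1 ≤ n → k ≤ n → (w w' : List ℤ)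
    → (hw : InWk n k w) → (hw' : InWk n k w') → Covers n w w'
    → (TypeB1 k w w' ⇔ TypeB1 k (dual hw') (dual hw))
      × (TypeB2 k w w' ⇔ TypeB2 k (dual hw') (dual hw))
      × (TypeB3 k w w' ⇔ TypeB4 k (dual hw') (dual hw))
mainTheorem7 n k _ _ w w' hw hw' _ =
    via (typeB1⇔ S S') (mk⇔ (dual-B1 sep) (dual-B1 sep'ᵛ)) (typeB1⇔ D' D)
  , via (typeB2⇔ S S') (mk⇔ (dual-B2 sep) (dual-B2 sep'ᵛ)) (typeB2⇔ D' D)
  , via (typeB3⇔ S S' sep) (mk⇔ (dual-B3 sep) (dual-B4 sep'ᵛ)) (typeB4⇔ D' D)
  where
  S : Shape k w
  S  = shape hw
  S' : Shape k w'
  S' = shape hw'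
  D : Shape k (dual hw)
  D  = dualShape hw
  D' : Shape k (dual hw')
  D' = dualShape hw'
  sep : Separated (tripleOf S)
  sep = separated hw
  sep'ᵛ : Separated (swapLV (tripleOf S'))
  sep'ᵛ = swapLV-separated (separated hw')
  via : ∀ {A B C E : Set} → A ⇔ B → B ⇔ C → E ⇔ C → A ⇔ E
  via A⇔B B⇔C E⇔C = ⇔-trans A⇔B (⇔-trans B⇔C (⇔-sym E⇔C))
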